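{- Let $F_1,\dots,F_k$ be a $k$-MOFS$(n)$. Then it satisfies a non-trivial relation if and only if there exist a non-empty set $S\subseteq\{1,\dots,k\}$ and sets $R,Q\subseteq N(n)$ (either of which may be empty or all of $N(n)$) such that for all $(r,c)\in N(n)^2$, $\sum_{i\in S}F_i[r,c]\equiv 0\pmod 2$ if and only if ($r\in R\iff c\in Q$). Equivalently, the $\mathbb Z_2$-sum of the squares indexed by $S$ has, up to permutation of rows and columns, the block form $\begin{bmatrix}\mathbf 0&\mathbf 1\\ \mathbf 1&\mathbf 0\end{bmatrix}$ with constant (possibly degenerate) blocks.
   Context: Let $N(n)=\{1,\dots,n\}$ and let $n$ be even. A (binary) frequency square of order $n$ is an $n\times n$ array indexed by $N(n)\times N(n)$ with entries in $\{0,1\}$ such that every row and every column contains exactly $n/2$ zeros and $n/2$ ones. Two frequency squares $F,G$ of order $n$ are orthogonal if for each $(a,b)\in\{0,1\}^2$ the number of cells $(r,c)$ with $(F[r,c],G[r,c])=(a,b)$ equals $n^2/4$. A $k$-MOFS$(n)$ is an ordered set $F_1,\dots,F_k$ of pairwise orthogonal frequency squares of order $n$. Relations: form the $n^2\times(k+2)$ array $\mathcal O$ having a row $(i,j,F_1[i,j],\dots,F_k[i,j])$ for each $(i,j)\in N(n)^2$. Let $Y_1=Y_2=N(n)$ and $Y_c=\{0,1\}$ for $3\le c\le k+2$. A relation is a tuple $(X_1,\dots,X_{k+2})$ with $X_c\subseteq Y_c$ for all $c$ such that every row of $\mathcal O$ has an even number of positions $c$ for which the $c$-th entry of the row lies in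 $X_c$. A relation is trivial on column $c$ if $X_c=\emptyset$ or $X_c=Y_c$, and non-trivial if it is not trivial on at least one column. -}

module Defs where

open import Data.Nat using (ℕ; zero; suc; _+_; _*_; _/_)
open import Data.Nat.Divisibility using (_∣_)
open import Data.Bool using (Bool; true; false; not; _∧_; if_then_else_)
open import Data.Fin using (Fin; zero; suc)
open import Data.Product using (Σ; _×_; _,_; ∃; ∃-syntax)
open import Data.Sum using (_⊎_)
open import Relation.Binary.PropositionalEquality using (_≡_; _≢_)
open import Relation.Nullary using (¬_)

count : ∀ {n} → (Fin n → Bool) → ℕ
count {zero}  p = 0
count {suc n} p = (if p zero then 1 else 0) + count (λ i → p (suc i))

b2n : Bool → ℕ
b2n true  = 1
b2n false = 0

-- A binary n×n array; entry 'true' stands for 1, 'false' for 0.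
-- Rows/columns indexed by Fin n (standing for N(n) = {1,…,n}).
Square : ℕ → Set
Square n = Fin n → Fin n → Bool

IsFrequencySquare : ∀ n → Square n → Set
IsFrequencySquare n F =
  (∀ r → count (λ c → not (F r c)) ≡ n / 2 × count (λ c → F r c) ≡ n / 2) ×
  (∀ c → count (λ r → not (F r c)) ≡ n / 2 × count (λ r → F r c) ≡ n / 2)

sumFin : ∀ {n} → (Fin n → ℕ) → ℕ
sumFin {zero}  f = 0
sumFin {suc n} f = f zero + sumFin (λ i → f (suc i))

_=ᵇ_ : Bool → Bool → Bool
true  =ᵇ x = x
false =ᵇ x = not x

pairCount : ∀ {n} → Square n → Square n → Bool → Bool → ℕ
pairCount F G a b = sumFin (λ r → count (λ c → (F r c =ᵇ a) ∧ (G r c =ᵇ b)))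

Orthogonal : ∀ n → Square n → Square n → Set
Orthogonal n F G = ∀ a b → pairCount F G a b ≡ (n * n) / 4

IsMOFS : ∀ n k → (Fin k → Square n) → Set
IsMOFS n k F = (∀ i → IsFrequencySquare n (F i)) ×
               (∀ i j → i ≢ j → Orthogonal n (F i) (F j))

-- A relation (X₁, X₂, X₃, …, X_{k+2}): X₁, X₂ ⊆ N(n) as predicates Fin n → Bool,
-- X_{t+3} ⊆ {0,1} as a predicate Bool → Bool (for t : Fin k).
record RelData (n k : ℕ) : Set where
  constructor rel
  field
    X₁ : Fin n → Bool
    X₂ : Fin n → Bool
    Xs : Fin k → Bool → Bool

-- every row (i,j,F₁[i,j],…,F_k[i,j]) of 𝒪 has an even number of positions in the X's
IsRelation : ∀ {n k} → (Fin k → Square n) → RelData n k → Set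
IsRelation F (rel X₁ X₂ Xs) =
  ∀ i j → 2 ∣ (b2n (X₁ i) + b2n (X₂ j) + count (λ t → Xs t (F t i j)))

TrivialN : ∀ {n} → (Fin n → Bool) → Set
TrivialN X = (∀ x → X x ≡ false) ⊎ (∀ x → X x ≡ true)

TrivialB : (Bool → Bool) → Set
TrivialB X = (∀ x → X x ≡ false) ⊎ (∀ x → X x ≡ true)

NonTrivial : ∀ {n k} → RelData n k → Set
NonTrivial (rel X₁ X₂ Xs) = ¬ TrivialN X₁ ⊎ ¬ TrivialN X₂ ⊎ ∃[ t ] ¬ TrivialB (Xs t)

module Submission where

-- Over GF(2) every map X : {0,1} → {0,1} is affine, X(b) = s b + X(0) with slope
-- s = X(1) + X(0). So the relation condition on the row (i, j, F₁[i,j], …) reads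
-- X₁(i) + X₂(j) + Σ_{t ∈ S} F_t[i,j] + Σ_t X_t(0) ≡ 0, where S is the set of squares
-- with slope 1: a relation is exactly a splitting of the Z₂-sum of the squares in S
-- as R(r) + Q(c). Non-triviality forces S ≠ ∅, for with S = ∅ the identity
-- X₁(i) = X₂(j) + const makes every column set constant.

open import Defs
open import Data.Nat using (ℕ; zero; suc; _+_; _*_)
open import Data.Nat.Divisibility using (_∣_; divides; ∣-refl; ∣m∣n⇒∣m+n)
open import Data.Bool using (Bool; true; false; _∧_; not; _xor_; _≟_)
open import Data.Bool.Properties
  using (xor-∧-commutativeRing; not-distribˡ-xor; not-involutive; ¬-not; xor-assoc; xor-same;
         xor-identityʳ; ∧-identityʳ; ∧-zeroʳ)
open import Data.Fin using (Fin; zero; suc)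
open import Data.Fin.Properties using (any?)
open import Data.Product using (Σ; _×_; ∃-syntax; _,_)
open import Data.Sum using (_⊎_; inj₁; inj₂)
open import Data.Empty using (⊥-elim)
open import Function using (_∘_; id)
open import Function.Bundles using (_⇔_; mk⇔; Equivalence)
open import Relation.Nullary using (¬_; yes; no)
open import Relation.Binary.PropositionalEquality
  using (_≡_; refl; sym; trans; cong; cong₂; subst; module ≡-Reasoning)
open import Algebra.Bundles using (CommutativeRing)
open import Algebra.Properties.AbelianGroup (CommutativeRing.+-abelianGroup xor-∧-commutativeRing)
  using (inverseʳ-unique; x∙y⁻¹≈ε⇒x≈y; x≈y⇒x∙y⁻¹≈ε; x≈z//y; ∙-cancelʳ)
open import Algebra.Properties.CommutativeSemigroup
  (CommutativeRing.+-commutativeSemigroup xor-∧-commutativeRing)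
  using (interchange)

open Equivalence using (to; from)
open ≡-Reasoning

isOdd : ℕ → Bool
isOdd zero    = false
isOdd (suc n) = not (isOdd n)

isOdd-+ : ∀ m n → isOdd (m + n) ≡ isOdd m xor isOdd n
isOdd-+ zero    n = refl
isOdd-+ (suc m) n = trans (cong not (isOdd-+ m n)) (not-distribˡ-xor (isOdd m) (isOdd n))

isOdd-b2n : ∀ b → isOdd (b2n b) ≡ b
isOdd-b2n true  = refl
isOdd-b2n false = refl

isOdd-*2 : ∀ q → isOdd (q * 2) ≡ false
isOdd-*2 zero    = refl
isOdd-*2 (suc q) = trans (not-involutive _) (isOdd-*2 q)

isOdd≡false⇒2∣ : ∀ m → isOdd m ≡ false → 2 ∣ m
isOdd≡false⇒2∣ zero          _ = divides 0 refl
isOdd≡false⇒2∣ (suc (suc m)) e =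
  ∣m∣n⇒∣m+n ∣-refl (isOdd≡false⇒2∣ m (trans (sym (not-involutive _)) e))

2∣⇔isOdd≡false : ∀ m → 2 ∣ m ⇔ isOdd m ≡ false
2∣⇔isOdd≡false m = mk⇔ (λ { (divides q refl) → isOdd-*2 q }) (isOdd≡false⇒2∣ m)

isOdd-count-suc : ∀ {n} (p : Fin (suc n) → Bool) →
                  isOdd (count p) ≡ p zero xor isOdd (count (p ∘ suc))
isOdd-count-suc p with p zero
... | true  = refl
... | false = refl

isOdd-count-xor : ∀ {n} (r p q : Fin n → Bool) → (∀ t → r t ≡ p t xor q t) →
                  isOdd (count r) ≡ isOdd (count p) xor isOdd (count q)
isOdd-count-xor {zero}  r p q h = refl
isOdd-count-xor {suc n} r p q h = begin
  isOdd (count r)                                   ≡⟨ isOdd-count-suc r ⟩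
  r zero xor isOdd (count (r ∘ suc))                ≡⟨ cong₂ _xor_ (h zero) (isOdd-count-xor _ _ _ (h ∘ suc)) ⟩
  (p zero xor q zero) xor (P xor Q)                 ≡⟨ interchange (p zero) (q zero) P Q ⟩
  (p zero xor P) xor (q zero xor Q)                 ≡⟨ cong₂ _xor_ (isOdd-count-suc p) (isOdd-count-suc q) ⟨
  isOdd (count p) xor isOdd (count q)               ∎
  where
  P = isOdd (count (p ∘ suc))
  Q = isOdd (count (q ∘ suc))

count-≡0 : ∀ {n} (p : Fin n → Bool) → (∀ t → p t ≡ false) → count p ≡ 0
count-≡0 {zero}  p h = refl
count-≡0 {suc n} p h rewrite h zero = count-≡0 (p ∘ suc) (h ∘ suc)

≡-from-≡false⇔ : ∀ {x y : Bool} → (x ≡ false → y ≡ false) → (y ≡ false → x ≡ false) → x ≡ y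
≡-from-≡false⇔ {false} {false} _ _ = refl
≡-from-≡false⇔ {true}  {true}  _ _ = refl
≡-from-≡false⇔ {false} {true}  f _ = sym (f refl)
≡-from-≡false⇔ {true}  {false} _ g = g refl

2∣⇔≡⇔isOdd≡xor : ∀ m a b → (2 ∣ m ⇔ a ≡ b) ⇔ (isOdd m ≡ a xor b)
2∣⇔≡⇔isOdd≡xor m a b = mk⇔
  (λ h → ≡-from-≡false⇔ (x≈y⇒x∙y⁻¹≈ε ∘ to h ∘ from even) (to even ∘ from h ∘ x∙y⁻¹≈ε⇒x≈y a b))
  (λ e → mk⇔ (x∙y⁻¹≈ε⇒x≈y a b ∘ trans (sym e) ∘ to even) (from even ∘ trans e ∘ x≈y⇒x∙y⁻¹≈ε))
  where even = 2∣⇔isOdd≡false m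

slope : (Bool → Bool) → Bool
slope f = f true xor f false

affine : ∀ (f : Bool → Bool) b → f b ≡ (slope f ∧ b) xor f false
affine f false = sym (cong (_xor f false) (∧-zeroʳ (slope f)))
affine f true  = begin
  f true                              ≡⟨ xor-identityʳ (f true) ⟨
  f true xor false                    ≡⟨ cong (f true xor_) (xor-same (f false)) ⟨
  f true xor (f false xor f false)    ≡⟨ xor-assoc (f true) (f false) (f false) ⟨
  slope f xor f false                 ≡⟨ cong (_xor f false) (∧-identityʳ (slope f)) ⟨
  (slope f ∧ true) xor f false        ∎

constant⇒empty⊎full : ∀ {A : Set} (X : A → Bool) a → (∀ x → X x ≡ X a) →
                       (∀ x → X x ≡ false) ⊎ (∀ x → X x ≡ true)
constant⇒empty⊎full X a h with X a
... | false = inj₁ h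
... | true  = inj₂ h

constant⇒TrivialN : ∀ {n} (X : Fin n → Bool) → (∀ i j → X i ≡ X j) → TrivialN X
constant⇒TrivialN {zero}  X h = inj₁ λ ()
constant⇒TrivialN {suc n} X h = constant⇒empty⊎full X zero (λ i → h i zero)

slope≡false⇒TrivialB : ∀ f → slope f ≡ false → TrivialB f
slope≡false⇒TrivialB f e =
  constant⇒empty⊎full f false λ { true → x∙y⁻¹≈ε⇒x≈y _ _ e ; false → refl }

¬TrivialB-id : ¬ TrivialB id
¬TrivialB-id (inj₁ h) with () ← h true
¬TrivialB-id (inj₂ h) with () ← h false

xorSum : ∀ {n k} → (Fin k → Square n) → (Fin k → Bool) → Square n
xorSum F S r c = isOdd (count (λ t → S t ∧ F t r c))

offset : ∀ {k} → (Fin k → Bool → Bool) → Bool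
offset Xs = isOdd (count (λ t → Xs t false))

isOdd-row : ∀ a b m → isOdd (b2n a + b2n b + m) ≡ (a xor b) xor isOdd m
isOdd-row a b m = begin
  isOdd (b2n a + b2n b + m)                       ≡⟨ isOdd-+ (b2n a + b2n b) m ⟩
  isOdd (b2n a + b2n b) xor isOdd m               ≡⟨ cong (_xor isOdd m) (isOdd-+ (b2n a) (b2n b)) ⟩
  (isOdd (b2n a) xor isOdd (b2n b)) xor isOdd m   ≡⟨ cong (_xor isOdd m) (cong₂ _xor_ (isOdd-b2n a) (isOdd-b2n b)) ⟩
  (a xor b) xor isOdd m                           ∎

HasBlockForm : ∀ {n} → Square n → Set
HasBlockForm {n} G = Σ (Fin n → Bool) λ R → Σ (Fin n → Bool) λ Q → ∀ r c → G r c ≡ R r xor Q c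

module _ {n k} (F : Fin k → Square n) where

  relation⇒xorSum : ∀ X₁ X₂ Xs → IsRelation F (rel X₁ X₂ Xs) →
                    ∀ i j → xorSum F (slope ∘ Xs) i j ≡ X₁ i xor (X₂ j xor offset Xs)
  relation⇒xorSum X₁ X₂ Xs isRel i j =
    trans (x≈z//y s c _ (inverseʳ-unique (X₁ i xor X₂ j) (s xor c) rowParity)) (xor-assoc (X₁ i) (X₂ j) c)
    where
    s = xorSum F (slope ∘ Xs) i j
    c = offset Xs
    rowParity : (X₁ i xor X₂ j) xor (s xor c) ≡ false
    rowParity = begin
      (X₁ i xor X₂ j) xor (s xor c)
        ≡⟨ cong ((X₁ i xor X₂ j) xor_) (isOdd-count-xor _ _ _ (λ t → affine (Xs t) (F t i j))) ⟨
      (X₁ i xor X₂ j) xor isOdd (count (λ t → Xs t (F t i j)))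
        ≡⟨ isOdd-row (X₁ i) (X₂ j) _ ⟨
      isOdd (b2n (X₁ i) + b2n (X₂ j) + count (λ t → Xs t (F t i j)))
        ≡⟨ to (2∣⇔isOdd≡false _) (isRel i j) ⟩
      false ∎

  xorSum⇒relation : ∀ S R Q → (∀ i j → xorSum F S i j ≡ R i xor Q j) →
                    IsRelation F (rel R Q (λ t → S t ∧_))
  xorSum⇒relation S R Q block i j = from (2∣⇔isOdd≡false _) (begin
    isOdd (b2n (R i) + b2n (Q j) + count (λ t → S t ∧ F t i j))  ≡⟨ isOdd-row (R i) (Q j) _ ⟩
    (R i xor Q j) xor xorSum F S i j                             ≡⟨ cong ((R i xor Q j) xor_) (block i j) ⟩
    (R i xor Q j) xor (R i xor Q j)                              ≡⟨ xor-same (R i xor Q j) ⟩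
    false                                                        ∎)

  flat⇒¬NonTrivial : ∀ X₁ X₂ Xs → IsRelation F (rel X₁ X₂ Xs) →
                     (∀ t → slope (Xs t) ≡ false) → ¬ NonTrivial (rel X₁ X₂ Xs)
  flat⇒¬NonTrivial X₁ X₂ Xs isRel flat
    = λ { (inj₁ ¬triv₁)              → ¬triv₁ (constant⇒TrivialN X₁ X₁-constant)
        ; (inj₂ (inj₁ ¬triv₂))       → ¬triv₂ (constant⇒TrivialN X₂ X₂-constant)
        ; (inj₂ (inj₂ (t , ¬trivₜ))) → ¬trivₜ (slope≡false⇒TrivialB (Xs t) (flat t)) }
    where
    c = offset Xs
    X₁≡X₂+c : ∀ i j → X₁ i ≡ X₂ j xor c
    X₁≡X₂+c i j = x∙y⁻¹≈ε⇒x≈y (X₁ i) (X₂ j xor c) (trans (sym (relation⇒xorSum X₁ X₂ Xs isRel i j))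
      (cong isOdd (count-≡0 _ (λ t → cong (_∧ F t i j) (flat t)))))
    X₁-constant : ∀ i j → X₁ i ≡ X₁ j
    X₁-constant i j = trans (X₁≡X₂+c i j) (sym (X₁≡X₂+c j j))
    X₂-constant : ∀ i j → X₂ i ≡ X₂ j
    X₂-constant i j = ∙-cancelʳ c (X₂ i) (X₂ j) (trans (sym (X₁≡X₂+c i i)) (X₁≡X₂+c i j))

  nonTrivial⇒slope≡true : ∀ X₁ X₂ Xs → IsRelation F (rel X₁ X₂ Xs) → NonTrivial (rel X₁ X₂ Xs) →
                          ∃[ t ] slope (Xs t) ≡ true
  nonTrivial⇒slope≡true X₁ X₂ Xs isRel nonTriv with any? (λ t → slope (Xs t) ≟ true)
  ... | yes steep = steep
  ... | no ¬steep = ⊥-elim (flat⇒¬NonTrivial X₁ X₂ Xs isRel (λ t → ¬-not (λ e → ¬steep (t , e))) nonTriv)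

  relation⇔blockForm : (Σ (RelData n k) λ X → IsRelation F X × NonTrivial X)
                       ⇔ (Σ (Fin k → Bool) λ S → (∃[ t ] S t ≡ true) × HasBlockForm (xorSum F S))
  relation⇔blockForm = mk⇔
    (λ { (rel X₁ X₂ Xs , isRel , nonTriv) →
           slope ∘ Xs , nonTrivial⇒slope≡true X₁ X₂ Xs isRel nonTriv ,
           X₁ , (λ j → X₂ j xor offset Xs) , relation⇒xorSum X₁ X₂ Xs isRel })
    (λ { (S , (t , Sₜ) , R , Q , block) →
           rel R Q (λ t → S t ∧_) , xorSum⇒relation S R Q block ,
           inj₂ (inj₂ (t , subst (λ s → ¬ TrivialB (s ∧_)) (sym Sₜ) ¬TrivialB-id)) })

lemma2p1 : ∀ (n k : ℕ) → 2 ∣ n → (F : Fin k → Square n) → IsMOFS n k F →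
           (Σ (RelData n k) λ X → (IsRelation F X × NonTrivial X))
           ⇔ (Σ (Fin k → Bool) λ S → Σ (Fin n → Bool) λ R → Σ (Fin n → Bool) λ Q → ((Σ (Fin k) λ t → S t ≡ true) ×
               (∀ (r c : Fin n) →
                  (2 ∣ count (λ t → S t ∧ F t r c)) ⇔ (R r ≡ Q c))))
lemma2p1 n k _ F _ = mk⇔ (toDivisibility ∘ to (relation⇔blockForm F)) (from (relation⇔blockForm F) ∘ toParity)
  where
  parityForm divisibilityForm : (Fin k → Bool) → Set
  parityForm S = (∃[ t ] S t ≡ true) × HasBlockForm (xorSum F S)
  divisibilityForm S = Σ (Fin n → Bool) λ R → Σ (Fin n → Bool) λ Q → (∃[ t ] S t ≡ true) ×
    (∀ r c → (2 ∣ count (λ t → S t ∧ F t r c)) ⇔ (R r ≡ Q c))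
  toDivisibility : Σ (Fin k → Bool) parityForm → Σ (Fin k → Bool) divisibilityForm
  toDivisibility (S , nonempty , R , Q , block) =
    S , R , Q , nonempty , λ r c → from (2∣⇔≡⇔isOdd≡xor _ (R r) (Q c)) (block r c)
  toParity : Σ (Fin k → Bool) divisibilityForm → Σ (Fin k → Bool) parityForm
  toParity (S , R , Q , nonempty , block) =
    S , nonempty , R , Q , λ r c → to (2∣⇔≡⇔isOdd≡xor _ (R r) (Q c)) (block r c)
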